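{- Let $A$ be a positive integer with $A\equiv \pm 3\pmod{24}$. If there exists a prime $p\equiv 2\pmod 3$ such that $v_p(A^2-9)$ is odd, then there does not exist a $\left(\tfrac14(A^2+3),\ \tfrac18(A-1)(A-3),\ \tfrac1{16}(A-3)(A-5)\right)$ cyclic difference set. Equivalently, there is no binary sequence $\mathbf a$ of period $n=\tfrac14(A^2+3)$ with $C_{\mathbf a}(t)=3$ for all $1\le t\le n-1$.
   Context: For a prime $p$ and a nonzero integer $m$, $v_p(m)$ is the exponent of the highest power of $p$ dividing $m$ ($v_p(0)=\infty$). An $(n,k,\lambda)$ cyclic difference set is a $k$-subset $D$ of a cyclic group $G$ of order $n$ such that every non-identity $g\in G$ has exactly $\lambda$ representations $g=xy^{ -1}$, $x,y\in D$. A binary sequence of period $n$ is $\mathbf a=(a_0,a_1,\ldots)$ with $a_j\in\{ -1,1\}$, $a_{j+n}=a_j$; $C_{\mathbf a}(t)=\sum_{i=0}^{n-1}a_ia_{i+t}$. -}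

module Defs where

open import Data.Nat using (ℕ; zero; suc; _+_; _*_; _∸_; _^_; _≤_; _<_; _≡ᵇ_)
open import Data.Nat.DivMod using (_%_; _/_)
open import Data.Nat.Divisibility using (_∣_)
open import Data.Integer as ℤ using (ℤ; +_; -[1+_])
open import Data.Fin using (Fin; toℕ)
open import Data.Fin.Subset using (Subset; _∈_; ∣_∣)
open import Data.Fin.Subset.Properties using (_∈?_)
open import Data.Bool using (Bool; _∧_)
open import Data.List using (List; length; filterᵇ; allFin; concatMap; map)
open import Data.Product using (_×_; _,_; ∃-syntax)
open import Relation.Nullary using (¬_)
open import Relation.Nullary.Decidable using (⌊_⌋)
open import Relation.Binary.PropositionalEquality using (_≡_; _≢_)

-- v_p(m) = e  (for m ≠ 0 this pins down the exponent; for m = 0 it is never satisfied)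
ValuationIs : ℕ → ℕ → ℕ → Set
ValuationIs p m e = (p ^ e ∣ m) × ¬ (p ^ suc e ∣ m)

OddValuation : ℕ → ℕ → Set
OddValuation p m = ∃[ j ] ValuationIs p m (1 + 2 * j)

-- the cyclic group of order n is modelled as ℤ/nℤ with carrier Fin n;
-- diffMod x y is the residue of x - y modulo n (as a natural number < n)
diffMod : ∀ {n} → Fin n → Fin n → ℕ
diffMod {zero} () _
diffMod {suc m} x y = (toℕ x + (suc m ∸ toℕ y)) % suc m

reps : ∀ {n} → Subset n → Fin n → ℕ
reps {n} D g =
  length (filterᵇ (λ xy → test (Data.Product.proj₁ xy) (Data.Product.proj₂ xy))
                  (concatMap (λ x → map (λ y → x , y) (allFin n)) (allFin n)))
  where
  test : Fin n → Fin n → Bool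
  test x y = ⌊ x ∈? D ⌋ ∧ ⌊ y ∈? D ⌋ ∧ (diffMod x y ≡ᵇ toℕ g)

IsCyclicDifferenceSet : (n k lam : ℕ) → Subset n → Set
IsCyclicDifferenceSet n k lam D =
  (∣ D ∣ ≡ k) × (∀ (g : Fin n) → toℕ g ≢ 0 → reps D g ≡ lam)

IsBinarySequence : ℕ → (ℕ → ℤ) → Set
IsBinarySequence n a = (∀ j → (a j ≡ + 1) Data.Sum.⊎ (a j ≡ -[1+ 0 ])) × (∀ j → a (j + n) ≡ a j)
  where import Data.Sum

sumℤ : ℕ → (ℕ → ℤ) → ℤ
sumℤ zero f = + 0
sumℤ (suc n) f = sumℤ n f ℤ.+ f n

autocorr : ℕ → (ℕ → ℤ) → ℕ → ℤ
autocorr n a t = sumℤ n (λ i → a i ℤ.* a (i + t))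

-- Let f have period n = 3N and let C be its autocorrelation, constant (= c) off the peak. Summing
-- C over all shifts and over the shifts divisible by 3 expresses C(0) − c as the Eisenstein norm
-- u² − uv + v² of two integers built from the sums of f over the residue classes mod 3. For the
-- indicator of a difference set C(0) − c = k − λ, for a ±1 sequence it is n − c. On the other hand,
-- for a prime p ≡ 2 (mod 3), p ∣ u² − uv + v² forces p ∣ u, v (via Fermat's little theorem), so the
-- norm has even p-adic valuation. With the parameters of the theorem 16(k − λ) = 4(n − 3) = A² − 9.
module Submission where

open import Defs
open import Data.Product using (_×_; _,_; proj₁; proj₂; ∃-syntax)
open import Data.Sum using (_⊎_; inj₁; inj₂; [_,_]′)
open import Data.Empty using (⊥; ⊥-elim)
open import Relation.Nullary using (¬_; yes; no)
open import Relation.Nullary.Decidable using (toWitnessFalse)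
open import Relation.Binary.PropositionalEquality

module NumberTheory where

  open import Data.Nat as ℕ using (ℕ; zero; suc)
  import Data.Nat.Properties as ℕP
  import Data.Nat.Divisibility as ℕD
  import Data.Nat.DivMod as ℕDM
  import Data.Nat.Tactic.RingSolver as ℕSolver
  open import Data.Nat.Combinatorics using (_C_; nCn≡1; nC1≡n; nCk+nC[k+1]≡[n+1]C[k+1])
  open import Data.Nat.Primality using (Prime; euclidsLemma)
  import Data.Integer
  open import Data.Integer using (ℤ; +_; _+_; _*_; _-_; -_; _^_; ∣_∣)
  import Data.Integer.Properties as ℤP
  open import Data.Integer.DivMod using (_%ℕ_; _/ℕ_; a≡a%ℕn+[a/ℕn]*n)
  open import Data.Integer.Divisibility.Signed
    using (_∣_; _∣?_; divides; ∣ᵤ⇒∣; ∣⇒∣ᵤ; ∣m∣n⇒∣m+n; ∣m∣n⇒∣m-n; ∣n⇒∣m*n; ∣m⇒∣m*n)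
  open import Data.Integer.Tactic.RingSolver using (solve-∀)
  open import Data.Fin using (Fin; toℕ; inject₁; fromℕ)
  import Data.Fin.Properties as FinP
  open import Data.Vec.Functional using (Vector)
  open import Algebra.Definitions.RawMonoid Data.Integer.+-0-rawMonoid using (sum) renaming (_×_ to _times_)
  import Algebra.Properties.CommutativeSemiring.Binomial ℤP.+-*-commutativeSemiring as Binomial
  import Algebra.Properties.Monoid.Sum ℤP.+-0-monoid as MonoidSum
  import Algebra.Properties.Semiring.Exp ℤP.+-*-semiring as SemiringExp

  absorption : ∀ n k → suc k ℕ.* (suc n C suc k) ≡ suc n ℕ.* (n C k)
  absorption zero zero = refl
  absorption zero (suc k) = ℕP.*-zeroʳ (suc (suc k))
  absorption (suc n) zero =
    trans (ℕP.*-identityˡ _) (trans (nC1≡n (suc (suc n))) (sym (ℕP.*-identityʳ _)))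
  absorption (suc n) (suc k) = begin
      suc (suc k) ℕ.* (suc (suc n) C suc (suc k))
    ≡⟨ cong (suc (suc k) ℕ.*_) (sym (nCk+nC[k+1]≡[n+1]C[k+1] (suc n) (suc k))) ⟩
      suc (suc k) ℕ.* (a ℕ.+ b)
    ≡⟨ regroup₁ k a b ⟩
      a ℕ.+ suc k ℕ.* a ℕ.+ suc (suc k) ℕ.* b
    ≡⟨ cong₂ (λ x y → a ℕ.+ x ℕ.+ y) (absorption n k) (absorption n (suc k)) ⟩
      a ℕ.+ suc n ℕ.* (n C k) ℕ.+ suc n ℕ.* (n C suc k)
    ≡⟨ regroup₂ n a (n C k) (n C suc k) ⟩
      a ℕ.+ suc n ℕ.* ((n C k) ℕ.+ (n C suc k))
    ≡⟨ cong (λ x → a ℕ.+ suc n ℕ.* x) (nCk+nC[k+1]≡[n+1]C[k+1] n k) ⟩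
      suc (suc n) ℕ.* a ∎
    where
    open ≡-Reasoning
    a = suc n C suc k
    b = suc n C suc (suc k)
    regroup₁ : ∀ k a b → suc (suc k) ℕ.* (a ℕ.+ b) ≡ a ℕ.+ suc k ℕ.* a ℕ.+ suc (suc k) ℕ.* b
    regroup₁ = ℕSolver.solve-∀
    regroup₂ : ∀ n a c d → a ℕ.+ suc n ℕ.* c ℕ.+ suc n ℕ.* d ≡ a ℕ.+ suc n ℕ.* (c ℕ.+ d)
    regroup₂ = ℕSolver.solve-∀

  -- A prime p divides C(p,k) for 0 < k < p: it divides k·C(p,k) = p·C(p-1,k-1) but not k.
  prime∣choose : ∀ {p k} → Prime p → 0 ℕ.< k → k ℕ.< p → p ℕD.∣ p C k
  prime∣choose {suc n} {suc j} pr _ k<p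
    with euclidsLemma (suc j) (suc n C suc j) pr
           (ℕD.divides (n C j) (trans (absorption n j) (ℕP.*-comm (suc n) (n C j))))
  ... | inj₂ p∣C = p∣C
  ... | inj₁ p∣k = ⊥-elim (ℕP.<⇒≱ k<p (ℕD.∣⇒≤ p∣k))

  ∣-sum : ∀ {d n} (t : Vector ℤ n) → (∀ i → d ∣ t i) → d ∣ sum t
  ∣-sum {n = zero} t _ = divides (+ 0) refl
  ∣-sum {n = suc n} t d∣t = ∣m∣n⇒∣m+n (d∣t Fin.zero) (∣-sum (λ i → t (Fin.suc i)) (λ i → d∣t (Fin.suc i)))
    where import Data.Fin as Fin

  ×≡* : ∀ m x → m times x ≡ + m * x
  ×≡* zero x = sym (ℤP.*-zeroˡ x)
  ×≡* (suc m) x = trans (cong (_+_ x) (×≡* m x)) (sym (ℤP.suc-* (+ m) x))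

  ^≡^ : ∀ x m → x SemiringExp.^ m ≡ x ^ m
  ^≡^ x zero = refl
  ^≡^ x (suc m) = cong (x *_) (^≡^ x m)

  -- (x + 1)^p ≡ x^p + 1 (mod p): the binomial theorem with the middle coefficients divisible by p.
  freshman : ∀ {p} → Prime p → ∀ x → + p ∣ (x + + 1) ^ p - (x ^ p + + 1)
  freshman {suc n} pr x = subst (+ p ∣_) (sym difference) (∣-sum {+ p} {n} middle middle-divisible)
    where
    open ≡-Reasoning
    p = suc n
    term : ℕ → ℤ
    term k = + (p C k) * x ^ k
    middle : Vector ℤ n
    middle i = term (suc (toℕ (inject₁ i)))
    middle-divisible : ∀ i → + p ∣ middle i
    middle-divisible i = ∣m⇒∣m*n {m = + (p C k)} (x ^ k)
                           (∣ᵤ⇒∣ {+ p} {+ (p C k)} (prime∣choose pr (ℕ.s≤s ℕ.z≤n) (ℕ.s≤s i<n)))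
      where
      k = suc (toℕ (inject₁ i))
      i<n : toℕ (inject₁ i) ℕ.< n
      i<n = subst (ℕ._< n) (sym (FinP.toℕ-inject₁ i)) (FinP.toℕ<n i)
    library-term : ∀ k → Binomial.binomialTerm x (+ 1) p k ≡ term (toℕ k)
    library-term k = begin
        (p C toℕ k) times (x SemiringExp.^ toℕ k * (+ 1) SemiringExp.^ (p ℕ.∸ toℕ k))
      ≡⟨ ×≡* (p C toℕ k) _ ⟩
        + (p C toℕ k) * (x SemiringExp.^ toℕ k * (+ 1) SemiringExp.^ (p ℕ.∸ toℕ k))
      ≡⟨ cong₂ (λ u v → + (p C toℕ k) * (u * v)) (^≡^ x (toℕ k))
               (trans (^≡^ (+ 1) (p ℕ.∸ toℕ k)) (ℤP.^-zeroˡ (p ℕ.∸ toℕ k))) ⟩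
        + (p C toℕ k) * (x ^ toℕ k * + 1)
      ≡⟨ cong (+ (p C toℕ k) *_) (ℤP.*-identityʳ (x ^ toℕ k)) ⟩
        term (toℕ k) ∎
    last-term : term (suc (toℕ (fromℕ n))) ≡ x ^ p
    last-term = trans (cong (λ k → term (suc k)) (FinP.toℕ-fromℕ n))
                      (trans (cong (λ c → + c * x ^ p) (nCn≡1 p)) (ℤP.*-identityˡ (x ^ p)))
    expansion : (x + + 1) ^ p ≡ + 1 + (sum middle + x ^ p)
    expansion = begin
        (x + + 1) ^ p
      ≡⟨ sym (^≡^ (x + + 1) p) ⟩
        (x + + 1) SemiringExp.^ p
      ≡⟨ Binomial.theorem p x (+ 1) ⟩
        Binomial.binomialExpansion x (+ 1) p
      ≡⟨ MonoidSum.sum-cong-≗ {x = Binomial.binomialTerm x (+ 1) p} {y = λ k → term (toℕ k)} library-term ⟩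
        + 1 + sum (λ (i : Fin p) → term (suc (toℕ i)))
      ≡⟨ cong (_+_ (+ 1)) (MonoidSum.sum-init-last {n = n} (λ (i : Fin p) → term (suc (toℕ i)))) ⟩
        + 1 + (sum middle + term (suc (toℕ (fromℕ n))))
      ≡⟨ cong (λ z → + 1 + (sum middle + z)) last-term ⟩
        + 1 + (sum middle + x ^ p) ∎
    difference : (x + + 1) ^ p - (x ^ p + + 1) ≡ sum middle
    difference = trans (cong (_- (x ^ p + + 1)) expansion) (cancel (sum middle) (x ^ p))
      where
      cancel : ∀ m y → + 1 + (m + y) - (y + + 1) ≡ m
      cancel = solve-∀

  ∣-pow-sub : ∀ {d} a b k → d ∣ a - b → d ∣ a ^ k - b ^ k
  ∣-pow-sub a b zero _ = divides (+ 0) refl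
  ∣-pow-sub a b (suc k) d∣a-b =
    subst (_ ∣_) (sym (split a b (a ^ k) (b ^ k)))
      (∣m∣n⇒∣m+n (∣n⇒∣m*n a (∣-pow-sub a b k d∣a-b)) (∣m⇒∣m*n (b ^ k) d∣a-b))
    where
    split : ∀ a b x y → a * x - b * y ≡ a * (x - y) + (a - b) * y
    split = solve-∀

  -- Fermat's little theorem, first for naturals by induction using the freshman's dream ...
  fermat-ℕ : ∀ {p} → Prime p → ∀ a → + p ∣ (+ a) ^ p - + a
  fermat-ℕ {suc n} pr zero = divides (+ 0) refl
  fermat-ℕ {p} pr (suc a) =
    subst (+ p ∣_) (trans (telescope ((+ a + + 1) ^ p) ((+ a) ^ p) (+ a)) (cong (λ y → y ^ p - y) a+1≡suc-a))
      (∣m∣n⇒∣m+n (freshman pr (+ a)) (fermat-ℕ pr a))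
    where
    a+1≡suc-a : + a + + 1 ≡ + suc a
    a+1≡suc-a = cong +_ (ℕP.+-comm a 1)
    telescope : ∀ z y a → z - (y + + 1) + (y - a) ≡ z - (a + + 1)
    telescope = solve-∀

  -- ... then for all integers, through the residue modulo p.
  fermat : ∀ {p} → Prime p → ∀ x → + p ∣ x ^ p - x
  fermat {suc n} pr x =
    subst (+ p ∣_) (rearrange (x ^ p) (r ^ p) r x)
      (∣m∣n⇒∣m-n (∣m∣n⇒∣m+n (∣-pow-sub x r p x≡r) (fermat-ℕ pr (x %ℕ p))) x≡r)
    where
    p = suc n
    r = + (x %ℕ p)
    x≡r : + p ∣ x - r
    x≡r = divides (x /ℕ p) (trans (cong (_- r) (a≡a%ℕn+[a/ℕn]*n x p)) (cancel r (x /ℕ p * + p)))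
      where
      cancel : ∀ r t → r + t - r ≡ t
      cancel = solve-∀
    rearrange : ∀ a b c d → a - b + (b - c) - (d - c) ≡ a - d
    rearrange = solve-∀

  euclid-ℤ : ∀ {p} → Prime p → ∀ x y → + p ∣ x * y → (+ p ∣ x) ⊎ (+ p ∣ y)
  euclid-ℤ pr x y p∣xy with euclidsLemma ∣ x ∣ ∣ y ∣ pr (subst (_ ℕD.∣_) (ℤP.abs-* x y) (∣⇒∣ᵤ p∣xy))
  ... | inj₁ p∣x = inj₁ (∣ᵤ⇒∣ p∣x)
  ... | inj₂ p∣y = inj₂ (∣ᵤ⇒∣ p∣y)

  prime∣square : ∀ {p} → Prime p → ∀ x → + p ∣ x * x → + p ∣ x
  prime∣square pr x p∣xx with euclid-ℤ pr x x p∣xx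
  ... | inj₁ p∣x = p∣x
  ... | inj₂ p∣x = p∣x

  -- The norm form of the Eisenstein integers: N(u + vω) = u² − uv + v².
  normForm : ℤ → ℤ → ℤ
  normForm u v = u * u - u * v + v * v

  normForm-scale : ∀ c u v → normForm (c * u) (c * v) ≡ (c * c) * normForm u v
  normForm-scale c u v = expand c u v
    where
    expand : ∀ c u v → (c * u) * (c * u) - (c * u) * (c * v) + (c * v) * (c * v) ≡ (c * c) * (u * u - u * v + v * v)
    expand = solve-∀

  fermat-cubic : ∀ {p} K → Prime p → p ≡ 2 ℕ.+ K ℕ.* 3 → ∀ x → + p ∣ (x * x * x) ^ K * (x * x) - x
  fermat-cubic {p} K pr p≡ x = subst (λ y → + p ∣ y - x) (trans (cong (x ^_) p≡) (power-split K)) (fermat pr x)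
    where
    power-split : ∀ K → x ^ (2 ℕ.+ K ℕ.* 3) ≡ (x * x * x) ^ K * (x * x)
    power-split zero = square x
      where
      square : ∀ x → x * (x * + 1) ≡ + 1 * (x * x)
      square = solve-∀
    power-split (suc K) = trans (cong (λ y → x * (x * (x * y))) (power-split K)) (regroup x ((x * x * x) ^ K))
      where
      regroup : ∀ x y → x * (x * (x * (y * (x * x)))) ≡ (x * x * x) * y * (x * x)
      regroup = solve-∀

  2+3K∤3 : ∀ K → ¬ (2 ℕ.+ K ℕ.* 3) ℕD.∣ 3
  2+3K∤3 zero = toWitnessFalse {a? = 2 ℕD.∣? 3} _
  2+3K∤3 (suc K) d with ℕD.∣⇒≤ d
  ... | ℕ.s≤s (ℕ.s≤s (ℕ.s≤s ()))

  -- Multiplying by u + v gives u³ ≡ (−v)³; raising to the K-th power and applying Fermat's theorem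
  -- to u and −v yields p ∣ uv(u + v), hence v ≡ −u and p ∣ 3u², which is impossible.
  module _ {p : ℕ} (K : ℕ) (pr : Prime p) (p≡ : p ≡ 2 ℕ.+ K ℕ.* 3) {u v : ℤ}
           (p∣N : + p ∣ normForm u v) (p∤u : ¬ + p ∣ u) (p∤v : ¬ + p ∣ v) where

    private
      X Y : ℤ
      X = (u * u * u) ^ K
      Y = ((- v) * (- v) * (- v)) ^ K

      cubes : + p ∣ X - Y
      cubes = ∣-pow-sub (u * u * u) ((- v) * (- v) * (- v)) K
                (subst (+ p ∣_) (sum-of-cubes u v) (∣n⇒∣m*n (u + v) p∣N))
        where
        sum-of-cubes : ∀ u v → (u + v) * (u * u - u * v + v * v) ≡ u * u * u - (- v) * (- v) * (- v)
        sum-of-cubes = solve-∀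

      p∣uv[u+v] : + p ∣ u * v * (u + v)
      p∣uv[u+v] = subst (+ p ∣_) (sym (combination u v X Y))
        (∣m∣n⇒∣m+n (∣m∣n⇒∣m-n (∣n⇒∣m*n (u * u) (fermat-cubic K pr p≡ (- v)))
                               (∣n⇒∣m*n (v * v) (fermat-cubic K pr p≡ u)))
                   (∣n⇒∣m*n (u * u * (v * v)) cubes))
        where
        combination : ∀ u v X Y → u * v * (u + v) ≡
          u * u * (Y * ((- v) * (- v)) - - v) - v * v * (X * (u * u) - u) + u * u * (v * v) * (X - Y)
        combination = solve-∀

      p∣u+v : + p ∣ u + v
      p∣u+v = [ (λ p∣uv → ⊥-elim ([ p∤u , p∤v ]′ (euclid-ℤ pr u v p∣uv))) , (λ p∣u+v → p∣u+v) ]′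
                (euclid-ℤ pr (u * v) (u + v) p∣uv[u+v])

      p∣3u² : + p ∣ + 3 * (u * u)
      p∣3u² = subst (+ p ∣_) (three-squares u v) (∣m∣n⇒∣m+n p∣N (∣m⇒∣m*n (+ 2 * u - v) p∣u+v))
        where
        three-squares : ∀ u v → (u * u - u * v + v * v) + (u + v) * (+ 2 * u - v) ≡ + 3 * (u * u)
        three-squares = solve-∀

    coprime-norm-impossible : ⊥
    coprime-norm-impossible =
      [ (λ p∣3 → 2+3K∤3 K (subst (ℕD._∣ 3) p≡ (∣⇒∣ᵤ p∣3))) , (λ p∣uu → p∤u (prime∣square pr u p∣uu)) ]′
        (euclid-ℤ pr (+ 3) (u * u) p∣3u²)

  prime∣normForm : ∀ {p} → Prime p → p ℕ.% 3 ≡ 2 → ∀ u v → + p ∣ normForm u v → (+ p ∣ u) × (+ p ∣ v)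
  prime∣normForm {p} pr p%3≡2 u v p∣N with + p ∣? u | + p ∣? v
  ... | yes p∣u | _ = p∣u , prime∣square pr v (subst (+ p ∣_) (isolate-v² u v) p∣rest)
    where
    p∣rest : + p ∣ normForm u v - u * u + u * v
    p∣rest = ∣m∣n⇒∣m+n (∣m∣n⇒∣m-n p∣N (∣m⇒∣m*n u p∣u)) (∣m⇒∣m*n v p∣u)
    isolate-v² : ∀ u v → (u * u - u * v + v * v) - u * u + u * v ≡ v * v
    isolate-v² = solve-∀
  ... | no _ | yes p∣v = prime∣square pr u (subst (+ p ∣_) (isolate-u² u v) p∣rest) , p∣v
    where
    p∣rest : + p ∣ normForm u v - v * v + u * v
    p∣rest = ∣m∣n⇒∣m+n (∣m∣n⇒∣m-n p∣N (∣n⇒∣m*n v p∣v)) (∣n⇒∣m*n u p∣v)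
    isolate-u² : ∀ u v → (u * u - u * v + v * v) - v * v + u * v ≡ u * u
    isolate-u² = solve-∀
  ... | no p∤u | no p∤v = ⊥-elim (coprime-norm-impossible (p ℕ./ 3) pr p≡2+3K p∣N p∤u p∤v)
    where
    p≡2+3K : p ≡ 2 ℕ.+ (p ℕ./ 3) ℕ.* 3
    p≡2+3K = trans (ℕDM.m≡m%n+[m/n]*n p 3) (cong (ℕ._+ (p ℕ./ 3) ℕ.* 3) p%3≡2)

  -- So the p-adic valuation of u² − uv + v² is even: p ∣ u, v lets us divide the form by p² and descend.
  normForm-valuation-even : ∀ {p} → Prime p → p ℕ.% 3 ≡ 2 → ∀ u v → ¬ OddValuation p ∣ normForm u v ∣
  normForm-valuation-even {zero} _ ()
  normForm-valuation-even {suc n} pr p%3≡2 u v (j , valuation) = descent j u v valuation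
    where
    p = suc n

    p²-factor : ∀ e → p ℕ.^ (2 ℕ.+ e) ≡ (p ℕ.* p) ℕ.* p ℕ.^ e
    p²-factor e = sym (ℕP.*-assoc p p (p ℕ.^ e))

    odd-step : ∀ j → 1 ℕ.+ 2 ℕ.* suc j ≡ 2 ℕ.+ (1 ℕ.+ 2 ℕ.* j)
    odd-step = ℕSolver.solve-∀

    descent : ∀ j u v → ¬ ValuationIs p ∣ normForm u v ∣ (1 ℕ.+ 2 ℕ.* j)
    descent j u v (divides-odd , not-divides-next)
      with prime∣normForm pr p%3≡2 u v (∣ᵤ⇒∣ (ℕD.∣-trans (ℕD.m∣m*n _) divides-odd))
    ... | divides u′ refl , divides v′ refl = shift j divides-odd not-divides-next
      where
      M = ∣ normForm u′ v′ ∣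
      scaled : ∣ normForm (u′ * + p) (v′ * + p) ∣ ≡ (p ℕ.* p) ℕ.* M
      scaled = trans (cong ∣_∣ (trans (cong₂ normForm (ℤP.*-comm u′ (+ p)) (ℤP.*-comm v′ (+ p)))
                                      (normForm-scale (+ p) u′ v′)))
                     (ℤP.abs-* (+ p * + p) (normForm u′ v′))
      shift : ∀ j → p ℕ.^ (1 ℕ.+ 2 ℕ.* j) ℕD.∣ ∣ normForm (u′ * + p) (v′ * + p) ∣
                  → ¬ p ℕ.^ suc (1 ℕ.+ 2 ℕ.* j) ℕD.∣ ∣ normForm (u′ * + p) (v′ * + p) ∣ → ⊥
      shift zero _ not-divides-p² =
        not-divides-p² (subst₂ ℕD._∣_ (cong (p ℕ.*_) (sym (ℕP.*-identityʳ p))) (sym scaled) (ℕD.m∣m*n M))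
      shift (suc j) divides-odd′ not-divides′ = descent j u′ v′ (cancel divides-odd′ , λ d → not-divides′ (lift d))
        where
        instance
          p²-nonZero : ℕ.NonZero (p ℕ.* p)
          p²-nonZero = _
        cancel : p ℕ.^ (1 ℕ.+ 2 ℕ.* suc j) ℕD.∣ ∣ normForm (u′ * + p) (v′ * + p) ∣ → p ℕ.^ (1 ℕ.+ 2 ℕ.* j) ℕD.∣ M
        cancel d = ℕD.*-cancelˡ-∣ (p ℕ.* p)
          (subst₂ ℕD._∣_ (trans (cong (p ℕ.^_) (odd-step j)) (p²-factor (1 ℕ.+ 2 ℕ.* j))) scaled d)
        lift : p ℕ.^ suc (1 ℕ.+ 2 ℕ.* j) ℕD.∣ M → p ℕ.^ suc (1 ℕ.+ 2 ℕ.* suc j) ℕD.∣ ∣ normForm (u′ * + p) (v′ * + p) ∣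
        lift d = subst₂ ℕD._∣_ (sym (trans (cong (λ e → p ℕ.^ suc e) (odd-step j)) (p²-factor (suc (1 ℕ.+ 2 ℕ.* j)))))
                               (sym scaled) (ℕD.*-monoʳ-∣ (p ℕ.* p) d)

module Autocorrelation where

  open import Data.Nat as ℕ using (ℕ; zero; suc; _≡ᵇ_)
  import Data.Nat.Properties as ℕP
  open import Data.Nat.DivMod using (_%_; [m+kn]%n≡m%n; m*n%n≡0; %-distribˡ-+; m%n<n)
  open import Data.Integer using (ℤ; +_; _+_; _*_; _-_)
  import Data.Integer.Properties as ℤP
  open import Data.Integer.Tactic.RingSolver using (solve-∀)
  open import Data.Bool using (if_then_else_)
  open import Algebra.Properties.AbelianGroup ℤP.+-0-abelianGroup using (∙-cancelˡ)
  open NumberTheory using (normForm)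

  sumℤ-cong : ∀ n {f g : ℕ → ℤ} → (∀ i → i ℕ.< n → f i ≡ g i) → sumℤ n f ≡ sumℤ n g
  sumℤ-cong zero _ = refl
  sumℤ-cong (suc n) f≡g = cong₂ _+_ (sumℤ-cong n (λ i i<n → f≡g i (ℕP.m<n⇒m<1+n i<n))) (f≡g n ℕP.≤-refl)

  sumℤ-+ : ∀ n f g → sumℤ n (λ i → f i + g i) ≡ sumℤ n f + sumℤ n g
  sumℤ-+ zero f g = refl
  sumℤ-+ (suc n) f g = trans (cong (_+ (f n + g n)) (sumℤ-+ n f g)) (interchange (sumℤ n f) (sumℤ n g) (f n) (g n))
    where
    interchange : ∀ a b c d → a + b + (c + d) ≡ a + c + (b + d)
    interchange = solve-∀

  sumℤ-*ˡ : ∀ n c f → c * sumℤ n f ≡ sumℤ n (λ i → c * f i)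
  sumℤ-*ˡ zero c f = ℤP.*-zeroʳ c
  sumℤ-*ˡ (suc n) c f = trans (ℤP.*-distribˡ-+ c (sumℤ n f) (f n)) (cong (_+ c * f n) (sumℤ-*ˡ n c f))

  sumℤ-const : ∀ n c → sumℤ n (λ _ → c) ≡ + n * c
  sumℤ-const zero c = sym (ℤP.*-zeroˡ c)
  sumℤ-const (suc n) c = trans (cong (_+ c) (sumℤ-const n c)) (trans (ℤP.+-comm (+ n * c) c) (sym (ℤP.suc-* (+ n) c)))

  sumℤ-swap : ∀ n m (F : ℕ → ℕ → ℤ) → sumℤ n (λ t → sumℤ m (F t)) ≡ sumℤ m (λ i → sumℤ n (λ t → F t i))
  sumℤ-swap zero m F = sym (trans (sumℤ-const m (+ 0)) (ℤP.*-zeroʳ (+ m)))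
  sumℤ-swap (suc n) m F = trans (cong (_+ sumℤ m (F n)) (sumℤ-swap n m F)) (sym (sumℤ-+ m (λ i → sumℤ n (λ t → F t i)) (F n)))

  sumℤ-cons : ∀ n f → sumℤ (suc n) f ≡ f 0 + sumℤ n (λ t → f (suc t))
  sumℤ-cons zero f = trans (ℤP.+-identityˡ (f 0)) (sym (ℤP.+-identityʳ (f 0)))
  sumℤ-cons (suc n) f = trans (cong (_+ f (suc n)) (sumℤ-cons n f)) (ℤP.+-assoc (f 0) _ _)

  sumℤ-periodic : ∀ n (h : ℕ → ℤ) → (∀ x → h (x ℕ.+ n) ≡ h x) → ∀ i → sumℤ n (λ t → h (i ℕ.+ t)) ≡ sumℤ n h
  sumℤ-periodic n h periodic zero = refl
  sumℤ-periodic n h periodic (suc i) = begin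
      sumℤ n (λ t → h (suc i ℕ.+ t))
    ≡⟨ sumℤ-cong n (λ t _ → cong h (sym (ℕP.+-suc i t))) ⟩
      sumℤ n (λ t → g (suc t))
    ≡⟨ cancel (g 0) (sumℤ n (λ t → g (suc t))) ⟩
      g 0 + sumℤ n (λ t → g (suc t)) - g 0
    ≡⟨ cong (_- g 0) (sym (sumℤ-cons n g)) ⟩
      sumℤ n g + g n - g 0
    ≡⟨ cong₂ (λ a b → sumℤ n g + a - b) (periodic i) (cong h (ℕP.+-identityʳ i)) ⟩
      sumℤ n g + h i - h i
    ≡⟨ cancel′ (sumℤ n g) (h i) ⟩
      sumℤ n g
    ≡⟨ sumℤ-periodic n h periodic i ⟩
      sumℤ n h ∎
    where
    open ≡-Reasoning
    g : ℕ → ℤ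
    g t = h (i ℕ.+ t)
    cancel : ∀ a b → b ≡ a + b - a
    cancel = solve-∀
    cancel′ : ∀ a b → a + b - b ≡ a
    cancel′ = solve-∀

  δ : ℕ → ℕ → ℤ
  δ r s = if s ≡ᵇ r then + 1 else + 0

  w : ℕ → ℕ → ℤ
  w r x = δ r (x % 3)

  residue-expansion : ∀ (h : ℕ → ℤ) {r} → r ℕ.< 3 → ∀ a →
    a * h r ≡ h 0 * (δ 0 r * a) + h 1 * (δ 1 r * a) + h 2 * (δ 2 r * a)
  residue-expansion h {0} _ a = class₀ a (h 0) (h 1) (h 2)
    where
    class₀ : ∀ a x y z → a * x ≡ x * (+ 1 * a) + y * (+ 0 * a) + z * (+ 0 * a)
    class₀ = solve-∀
  residue-expansion h {1} _ a = class₁ a (h 0) (h 1) (h 2)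
    where
    class₁ : ∀ a x y z → a * y ≡ x * (+ 0 * a) + y * (+ 1 * a) + z * (+ 0 * a)
    class₁ = solve-∀
  residue-expansion h {2} _ a = class₂ a (h 0) (h 1) (h 2)
    where
    class₂ : ∀ a x y z → a * z ≡ x * (+ 0 * a) + y * (+ 0 * a) + z * (+ 1 * a)
    class₂ = solve-∀
  residue-expansion h {suc (suc (suc _))} (ℕ.s≤s (ℕ.s≤s (ℕ.s≤s ()))) _

  δ-translate : ∀ a b → a ℕ.< 3 → b ℕ.< 3 → δ 0 b ≡ δ a ((a ℕ.+ b) % 3)
  δ-translate 0 0 _ _ = refl
  δ-translate 0 1 _ _ = refl
  δ-translate 0 2 _ _ = refl
  δ-translate 1 0 _ _ = refl
  δ-translate 1 1 _ _ = refl
  δ-translate 1 2 _ _ = refl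
  δ-translate 2 0 _ _ = refl
  δ-translate 2 1 _ _ = refl
  δ-translate 2 2 _ _ = refl
  δ-translate (suc (suc (suc _))) _ (ℕ.s≤s (ℕ.s≤s (ℕ.s≤s ()))) _
  δ-translate _ (suc (suc (suc _))) _ (ℕ.s≤s (ℕ.s≤s (ℕ.s≤s ())))

  w-translate : ∀ i t → w 0 t ≡ w (i % 3) (i ℕ.+ t)
  w-translate i t = trans (δ-translate (i % 3) (t % 3) (m%n<n i 3) (m%n<n t 3))
                          (cong (δ (i % 3)) (sym (%-distribˡ-+ i t 3)))

  w-periodic : ∀ N r x → w r (x ℕ.+ N ℕ.* 3) ≡ w r x
  w-periodic N r x = cong (δ r) ([m+kn]%n≡m%n x N 3)

  count-multiples-of-3 : ∀ N → sumℤ (N ℕ.* 3) (w 0) ≡ + N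
  count-multiples-of-3 zero = refl
  count-multiples-of-3 (suc N) = begin
      sumℤ (N ℕ.* 3) (w 0) + w 0 (N ℕ.* 3) + w 0 (1 ℕ.+ N ℕ.* 3) + w 0 (2 ℕ.+ N ℕ.* 3)
    ≡⟨ cong (λ z → z + w 0 (1 ℕ.+ N ℕ.* 3) + w 0 (2 ℕ.+ N ℕ.* 3))
            (cong₂ _+_ (count-multiples-of-3 N) (cong (δ 0) (m*n%n≡0 N 3))) ⟩
      + N + + 1 + w 0 (1 ℕ.+ N ℕ.* 3) + w 0 (2 ℕ.+ N ℕ.* 3)
    ≡⟨ cong₂ (λ a b → + N + + 1 + a + b) (w-periodic N 0 1) (w-periodic N 0 2) ⟩
      + N + + 1 + + 0 + + 0
    ≡⟨ cong +_ (trans (ℕP.+-identityʳ _) (trans (ℕP.+-identityʳ _) (ℕP.+-comm N 1))) ⟩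
      + suc N ∎
    where open ≡-Reasoning

  -- Let f have period n = 3N, let s_r be the sum of f over the residue class r mod 3 in one
  -- period, and let the autocorrelation C be constant, equal to c, off the peak. Then
  --   Σ_t C(t) = (s₀ + s₁ + s₂)²     and     Σ_{3 ∣ t} C(t) = s₀² + s₁² + s₂²,
  -- while the left-hand sides are C(0) + (n − 1)c and C(0) + (N − 1)c; eliminating gives
  --   (s₀ − s₂)² − (s₀ − s₂)(s₁ − s₂) + (s₁ − s₂)² = C(0) − c.
  module OffPeak (N′ : ℕ) (f : ℕ → ℤ) (periodic : ∀ x → f (x ℕ.+ suc N′ ℕ.* 3) ≡ f x) (c : ℤ)
                 (constant : ∀ t → 1 ℕ.≤ t → t ℕ.< suc N′ ℕ.* 3 → autocorr (suc N′ ℕ.* 3) f t ≡ c) where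

    n : ℕ
    n = suc N′ ℕ.* 3

    C : ℕ → ℤ
    C = autocorr n f

    s : ℕ → ℤ
    s r = sumℤ n (λ i → w r i * f i)

    private
      residue-sum : ∀ h → sumℤ n (λ i → f i * h (i % 3)) ≡ h 0 * s 0 + h 1 * s 1 + h 2 * s 2
      residue-sum h = begin
          sumℤ n (λ i → f i * h (i % 3))
        ≡⟨ sumℤ-cong n (λ i _ → residue-expansion h (m%n<n i 3) (f i)) ⟩
          sumℤ n (λ i → part 0 i + part 1 i + part 2 i)
        ≡⟨ trans (sumℤ-+ n (λ i → part 0 i + part 1 i) (part 2)) (cong (_+ sumℤ n (part 2)) (sumℤ-+ n (part 0) (part 1))) ⟩
          sumℤ n (part 0) + sumℤ n (part 1) + sumℤ n (part 2)
        ≡⟨ sym (cong₂ _+_ (cong₂ _+_ (class-sum 0) (class-sum 1)) (class-sum 2)) ⟩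
          h 0 * s 0 + h 1 * s 1 + h 2 * s 2 ∎
        where
        open ≡-Reasoning
        part : ℕ → ℕ → ℤ
        part r i = h r * (w r i * f i)
        class-sum : ∀ r → h r * s r ≡ sumℤ n (part r)
        class-sum r = sumℤ-*ˡ n (h r) (λ i → w r i * f i)

      S : ℤ
      S = sumℤ n f

      S≡ : S ≡ s 0 + s 1 + s 2
      S≡ = trans (sumℤ-cong n (λ i _ → sym (ℤP.*-identityʳ (f i))))
                 (trans (residue-sum (λ _ → + 1)) (cong₂ _+_ (cong₂ _+_ (ℤP.*-identityˡ (s 0)) (ℤP.*-identityˡ (s 1))) (ℤP.*-identityˡ (s 2))))

      -- Σ_t C(t) = S², by exchanging the order of summation and periodicity.
      total : sumℤ n C ≡ S * S
      total = begin
          sumℤ n (λ t → sumℤ n (λ i → f i * f (i ℕ.+ t)))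
        ≡⟨ sumℤ-swap n n (λ t i → f i * f (i ℕ.+ t)) ⟩
          sumℤ n (λ i → sumℤ n (λ t → f i * f (i ℕ.+ t)))
        ≡⟨ sumℤ-cong n (λ i _ → trans (sym (sumℤ-*ˡ n (f i) (λ t → f (i ℕ.+ t))))
                                      (trans (cong (f i *_) (sumℤ-periodic n f periodic i)) (ℤP.*-comm (f i) S))) ⟩
          sumℤ n (λ i → S * f i)
        ≡⟨ sym (sumℤ-*ˡ n S f) ⟩
          S * S ∎
        where open ≡-Reasoning

      -- Σ_{3 ∣ t} C(t) = s₀² + s₁² + s₂²: the inner sum over t ≡ 0 of f(i + t) is s_{i mod 3}.
      shifted-class : ∀ i → sumℤ n (λ t → w 0 t * f (i ℕ.+ t)) ≡ s (i % 3)
      shifted-class i = trans (sumℤ-cong n (λ t _ → cong (_* f (i ℕ.+ t)) (w-translate i t)))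
                              (sumℤ-periodic n (λ x → w (i % 3) x * f x)
                                 (λ x → cong₂ _*_ (w-periodic (suc N′) (i % 3) x) (periodic x)) i)

      diagonal : sumℤ n (λ t → w 0 t * C t) ≡ s 0 * s 0 + s 1 * s 1 + s 2 * s 2
      diagonal = begin
          sumℤ n (λ t → w 0 t * sumℤ n (λ i → f i * f (i ℕ.+ t)))
        ≡⟨ sumℤ-cong n (λ t _ → sumℤ-*ˡ n (w 0 t) (λ i → f i * f (i ℕ.+ t))) ⟩
          sumℤ n (λ t → sumℤ n (λ i → w 0 t * (f i * f (i ℕ.+ t))))
        ≡⟨ sumℤ-swap n n (λ t i → w 0 t * (f i * f (i ℕ.+ t))) ⟩
          sumℤ n (λ i → sumℤ n (λ t → w 0 t * (f i * f (i ℕ.+ t))))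
        ≡⟨ sumℤ-cong n (λ i _ → trans (sumℤ-cong n (λ t _ → exchange (w 0 t) (f i) (f (i ℕ.+ t))))
                                      (trans (sym (sumℤ-*ˡ n (f i) (λ t → w 0 t * f (i ℕ.+ t))))
                                             (cong (f i *_) (shifted-class i)))) ⟩
          sumℤ n (λ i → f i * s (i % 3))
        ≡⟨ residue-sum s ⟩
          s 0 * s 0 + s 1 * s 1 + s 2 * s 2 ∎
        where
        open ≡-Reasoning
        exchange : ∀ a b d → a * (b * d) ≡ b * (a * d)
        exchange = solve-∀

      n-1 : ℕ
      n-1 = suc (suc (N′ ℕ.* 3))

      off-peak : ∀ t → t ℕ.< n-1 → C (suc t) ≡ c
      off-peak t t<n-1 = constant (suc t) (ℕ.s≤s ℕ.z≤n) (ℕ.s≤s t<n-1)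

      total′ : sumℤ n C ≡ C 0 + + n-1 * c
      total′ = trans (sumℤ-cons n-1 C) (cong (_+_ (C 0)) (trans (sumℤ-cong n-1 off-peak) (sumℤ-const n-1 c)))

      diagonal′ : sumℤ n (λ t → w 0 t * C t) ≡ C 0 + c * + N′
      diagonal′ = begin
          sumℤ n (λ t → w 0 t * C t)
        ≡⟨ sumℤ-cons n-1 (λ t → w 0 t * C t) ⟩
          + 1 * C 0 + sumℤ n-1 (λ t → w 0 (suc t) * C (suc t))
        ≡⟨ cong₂ _+_ (ℤP.*-identityˡ (C 0))
                     (sumℤ-cong n-1 (λ t t<n-1 → trans (cong (w 0 (suc t) *_) (off-peak t t<n-1)) (ℤP.*-comm _ c))) ⟩
          C 0 + sumℤ n-1 (λ t → c * w 0 (suc t))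
        ≡⟨ cong (_+_ (C 0)) (trans (sym (sumℤ-*ˡ n-1 c (λ t → w 0 (suc t)))) (cong (c *_) other-multiples)) ⟩
          C 0 + c * + N′ ∎
        where
        open ≡-Reasoning
        other-multiples : sumℤ n-1 (λ t → w 0 (suc t)) ≡ + N′
        other-multiples = ∙-cancelˡ (+ 1) _ _
          (trans (sym (sumℤ-cons n-1 (w 0))) (count-multiples-of-3 (suc N′)))

      n-1≡ : + n-1 ≡ + 2 + + N′ * + 3
      n-1≡ = trans (ℤP.pos-+ 2 (N′ ℕ.* 3)) (cong (_+_ (+ 2)) (ℤP.pos-* N′ 3))

      twice : + 2 * normForm (s 0 - s 2) (s 1 - s 2) ≡ + 2 * (C 0 - c)
      twice = begin
          + 2 * normForm (s 0 - s 2) (s 1 - s 2)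
        ≡⟨ classes (s 0) (s 1) (s 2) ⟩
          + 3 * (s 0 * s 0 + s 1 * s 1 + s 2 * s 2) - (s 0 + s 1 + s 2) * (s 0 + s 1 + s 2)
        ≡⟨ cong₂ (λ a b → + 3 * a - b * b) (trans (sym diagonal) diagonal′) (sym S≡) ⟩
          + 3 * (C 0 + c * + N′) - S * S
        ≡⟨ cong (λ z → + 3 * (C 0 + c * + N′) - z) (trans (sym total) (trans total′ (cong (λ z → C 0 + z * c) n-1≡))) ⟩
          + 3 * (C 0 + c * + N′) - (C 0 + (+ 2 + + N′ * + 3) * c)
        ≡⟨ eliminate (C 0) c (+ N′) ⟩
          + 2 * (C 0 - c) ∎
        where
        open ≡-Reasoning
        classes : ∀ a b d → + 2 * ((a - d) * (a - d) - (a - d) * (b - d) + (b - d) * (b - d))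
                          ≡ + 3 * (a * a + b * b + d * d) - (a + b + d) * (a + b + d)
        classes = solve-∀
        eliminate : ∀ a c x → + 3 * (a + c * x) - (a + (+ 2 + x * + 3) * c) ≡ + 2 * (a - c)
        eliminate = solve-∀

    off-peak-identity : normForm (s 0 - s 2) (s 1 - s 2) ≡ C 0 - c
    off-peak-identity = ℤP.*-cancelˡ-≡ (+ 2) _ _ twice

module DifferenceSets where

  open import Data.Nat as ℕ using (ℕ; zero; suc; _≡ᵇ_)
  import Data.Nat.Properties as ℕP
  import Data.Nat.Tactic.RingSolver as ℕSolver
  open import Data.Nat.DivMod using (_%_; _/_; [m+kn]%n≡m%n; m%n<n; m≡m%n+[m/n]*n; m<n⇒m%n≡m; m%n%n≡m%n)
  open import Data.Integer using (ℤ; +_; _+_; _*_)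
  import Data.Integer.Properties as ℤP
  open import Data.Bool using (Bool; true; false; if_then_else_; _∧_)
  open import Data.Bool.Properties using (T-≡)
  open import Data.Fin using (Fin; toℕ; fromℕ<; suc)
  import Data.Fin.Properties as FinP
  open import Data.Fin.Subset using (Subset; Side; ∣_∣; inside; outside)
  open import Data.Fin.Subset.Properties using (_∈?_)
  open import Data.List using (List; []; _∷_; _++_; length; filterᵇ; allFin; concatMap; map; tabulate; foldr)
  import Data.List.Properties as LP
  open import Data.Vec using ([]; _∷_)
  open import Function.Bundles using (Equivalence)
  open import Relation.Nullary.Decidable using (⌊_⌋)
  open Autocorrelation using (sumℤ-cong; sumℤ-const; sumℤ-cons)

  ι : Bool → ℤ
  ι b = if b then + 1 else + 0

  listSum : List ℤ → ℤ
  listSum = foldr _+_ (+ 0)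

  count-filter : ∀ {A : Set} (P : A → Bool) xs → + length (filterᵇ P xs) ≡ listSum (map (λ x → ι (P x)) xs)
  count-filter P [] = refl
  count-filter P (x ∷ xs) with P x
  ... | true = cong (_+_ (+ 1)) (count-filter P xs)
  ... | false = trans (count-filter P xs) (sym (ℤP.+-identityˡ _))

  listSum-++ : ∀ xs ys → listSum (xs ++ ys) ≡ listSum xs + listSum ys
  listSum-++ [] ys = sym (ℤP.+-identityˡ _)
  listSum-++ (x ∷ xs) ys = trans (cong (_+_ x) (listSum-++ xs ys)) (sym (ℤP.+-assoc x _ _))

  listSum-concatMap : ∀ {A B : Set} (G : B → ℤ) (h : A → List B) xs →
    listSum (map G (concatMap h xs)) ≡ listSum (map (λ x → listSum (map G (h x))) xs)
  listSum-concatMap G h [] = refl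
  listSum-concatMap G h (x ∷ xs) =
    trans (cong listSum (LP.map-++ G (h x) (concatMap h xs)))
          (trans (listSum-++ (map G (h x)) (map G (concatMap h xs))) (cong (_+_ (listSum (map G (h x)))) (listSum-concatMap G h xs)))

  listSum-allFin : ∀ n (G : ℕ → ℤ) → listSum (map (λ x → G (toℕ x)) (allFin n)) ≡ sumℤ n G
  listSum-allFin n G = trans (cong listSum (LP.map-tabulate {n = n} (λ x → x) (λ x → G (toℕ x)))) (over-tabulate n G)
    where
    over-tabulate : ∀ n (G : ℕ → ℤ) → listSum (tabulate {n = n} (λ x → G (toℕ x))) ≡ sumℤ n G
    over-tabulate zero G = refl
    over-tabulate (suc n) G = trans (cong (_+_ (G 0)) (over-tabulate n (λ i → G (suc i)))) (sym (sumℤ-cons n G))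

  sumℤ-single : ∀ n (h : ℕ → ℤ) j₀ → j₀ ℕ.< n → (∀ j → j ℕ.< n → j ≢ j₀ → h j ≡ + 0) → sumℤ n h ≡ h j₀
  sumℤ-single (suc n) h j₀ j₀<1+n zero-elsewhere with j₀ ℕP.≟ n
  ... | yes refl = trans (cong (_+ h n) vanishing) (ℤP.+-identityˡ (h n))
    where
    vanishing : sumℤ n h ≡ + 0
    vanishing = trans (sumℤ-cong n (λ j j<n → zero-elsewhere j (ℕP.m<n⇒m<1+n j<n) (λ j≡n → ℕP.<-irrefl j≡n j<n)))
                      (trans (sumℤ-const n (+ 0)) (ℤP.*-zeroʳ (+ n)))
  ... | no j₀≢n = trans (cong₂ _+_ (sumℤ-single n h j₀ j₀<n (λ j j<n → zero-elsewhere j (ℕP.m<n⇒m<1+n j<n)))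
                                   (zero-elsewhere n ℕP.≤-refl (λ n≡j₀ → j₀≢n (sym n≡j₀))))
                        (ℤP.+-identityʳ (h j₀))
    where
    j₀<n : j₀ ℕ.< n
    j₀<n = ℕP.≤∧≢⇒< (ℕP.≤-pred j₀<1+n) j₀≢n

  -- In ℤ/nℤ, x − y = g iff x − g = y (residues written as (a + (n − b)) mod n).
  difference-swap : ∀ n .{{_ : ℕ.NonZero n}} x y g → y ℕ.< n → g ℕ.≤ n →
    (x ℕ.+ (n ℕ.∸ y)) % n ≡ g → (x ℕ.+ (n ℕ.∸ g)) % n ≡ y
  difference-swap n x y g y<n g≤n x-y≡g =
    trans (cong (_% n) x-g≡y+qn) (trans ([m+kn]%n≡m%n y q n) (m<n⇒m%n≡m y<n))
    where
    q = (x ℕ.+ (n ℕ.∸ y)) / n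
    x+n≡ : x ℕ.+ n ≡ g ℕ.+ q ℕ.* n ℕ.+ y
    x+n≡ = begin
        x ℕ.+ n
      ≡⟨ cong (x ℕ.+_) (sym (ℕP.m∸n+n≡m (ℕP.<⇒≤ y<n))) ⟩
        x ℕ.+ (n ℕ.∸ y ℕ.+ y)
      ≡⟨ sym (ℕP.+-assoc x (n ℕ.∸ y) y) ⟩
        x ℕ.+ (n ℕ.∸ y) ℕ.+ y
      ≡⟨ cong (ℕ._+ y) (trans (m≡m%n+[m/n]*n (x ℕ.+ (n ℕ.∸ y)) n) (cong (ℕ._+ q ℕ.* n) x-y≡g)) ⟩
        g ℕ.+ q ℕ.* n ℕ.+ y ∎
      where open ≡-Reasoning
    x-g≡y+qn : x ℕ.+ (n ℕ.∸ g) ≡ y ℕ.+ q ℕ.* n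
    x-g≡y+qn = ℕP.+-cancelʳ-≡ g _ _ (begin
        x ℕ.+ (n ℕ.∸ g) ℕ.+ g
      ≡⟨ trans (ℕP.+-assoc x (n ℕ.∸ g) g) (cong (x ℕ.+_) (ℕP.m∸n+n≡m g≤n)) ⟩
        x ℕ.+ n
      ≡⟨ x+n≡ ⟩
        g ℕ.+ q ℕ.* n ℕ.+ y
      ≡⟨ rotate g (q ℕ.* n) y ⟩
        y ℕ.+ q ℕ.* n ℕ.+ g ∎)
      where
      open ≡-Reasoning
      rotate : ∀ a b c → a ℕ.+ b ℕ.+ c ≡ c ℕ.+ b ℕ.+ a
      rotate = ℕSolver.solve-∀

  tail-membership : ∀ {k} (s : Side) (E : Subset k) →
    tabulate (λ x → ι ⌊ x ∈? E ⌋) ≡ tabulate (λ x → ι ⌊ suc x ∈? (s ∷ E) ⌋)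
  tail-membership s E = LP.tabulate-cong (λ x → cong ι (membership x))
    where
    membership : ∀ x → ⌊ x ∈? E ⌋ ≡ ⌊ suc x ∈? (s ∷ E) ⌋
    membership x with x ∈? E
    ... | yes _ = refl
    ... | no _ = refl

  size-as-sum : ∀ {k} (E : Subset k) → + ∣ E ∣ ≡ listSum (tabulate (λ x → ι ⌊ x ∈? E ⌋))
  size-as-sum {zero} [] = refl
  size-as-sum {suc k} (inside ∷ E) = cong (_+_ (+ 1)) (trans (size-as-sum E) (cong listSum (tail-membership inside E)))
  size-as-sum {suc k} (outside ∷ E) =
    trans (size-as-sum E) (trans (sym (ℤP.+-identityˡ _)) (cong (_+_ (+ 0)) (cong listSum (tail-membership outside E))))

  module Indicator (m : ℕ) (D : Subset (suc m)) where

    n : ℕ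
    n = suc m

    toFin : ℕ → Fin n
    toFin i = fromℕ< (m%n<n i n)

    toℕ-toFin : ∀ i → toℕ (toFin i) ≡ i % n
    toℕ-toFin i = FinP.toℕ-fromℕ< (m%n<n i n)

    toFin-toℕ : ∀ x → toFin (toℕ x) ≡ x
    toFin-toℕ x = FinP.toℕ-injective (trans (toℕ-toFin (toℕ x)) (m<n⇒m%n≡m (FinP.toℕ<n x)))

    toFin-mod : ∀ i → toFin (i % n) ≡ toFin i
    toFin-mod i = FinP.toℕ-injective (trans (toℕ-toFin (i % n)) (trans (m%n%n≡m%n i n) (sym (toℕ-toFin i))))

    ind : Fin n → ℤ
    ind x = ι ⌊ x ∈? D ⌋

    f : ℕ → ℤ
    f i = ind (toFin i)

    periodic : ∀ x → f (x ℕ.+ n) ≡ f x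
    periodic x = cong ind (trans (sym (toFin-mod (x ℕ.+ n))) (trans (cong toFin shift) (toFin-mod x)))
      where
      shift : (x ℕ.+ n) % n ≡ x % n
      shift = trans (cong (λ z → (x ℕ.+ z) % n) (sym (ℕP.*-identityˡ n))) ([m+kn]%n≡m%n x 1 n)

    test : Fin n → Fin n → Fin n → Bool
    test g x y = ⌊ x ∈? D ⌋ ∧ ⌊ y ∈? D ⌋ ∧ (diffMod x y ≡ᵇ toℕ g)

    -- For fixed x, exactly one y ∈ Fin n has x − y = g, namely y = x − g; so the number of
    -- admissible y is ind(x)·f(x + (n − g)).
    module _ (g x : Fin n) where
      private
        x−g : ℕ
        x−g = (toℕ x ℕ.+ (n ℕ.∸ toℕ g)) % n

        H : ℕ → ℤ
        H j = ι (test g x (toFin j))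

        ι-∧-false : ∀ a b → ι (a ∧ (b ∧ false)) ≡ + 0
        ι-∧-false true true = refl
        ι-∧-false true false = refl
        ι-∧-false false _ = refl

        ι-∧-true : ∀ a b → ι (a ∧ (b ∧ true)) ≡ ι a * ι b
        ι-∧-true true true = refl
        ι-∧-true true false = refl
        ι-∧-true false _ = refl

        H-zero : ∀ j → j ℕ.< n → j ≢ x−g → H j ≡ + 0
        H-zero j j<n j≢x−g with diffMod x (toFin j) ≡ᵇ toℕ g | ℕP.≡ᵇ⇒≡ (diffMod x (toFin j)) (toℕ g)
        ... | false | _ = ι-∧-false ⌊ x ∈? D ⌋ ⌊ toFin j ∈? D ⌋
        ... | true | x−j≡g = ⊥-elim (j≢x−g (sym (trans
              (difference-swap n (toℕ x) (toℕ (toFin j)) (toℕ g) (FinP.toℕ<n (toFin j)) (ℕP.<⇒≤ (FinP.toℕ<n g)) (x−j≡g _))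
              (trans (toℕ-toFin j) (m<n⇒m%n≡m j<n)))))

        x−[x−g]≡g : diffMod x (toFin x−g) ≡ toℕ g
        x−[x−g]≡g = difference-swap n (toℕ x) (toℕ g) (toℕ (toFin x−g)) (FinP.toℕ<n g) (ℕP.<⇒≤ (FinP.toℕ<n (toFin x−g)))
                      (sym (trans (toℕ-toFin x−g) (m%n%n≡m%n (toℕ x ℕ.+ (n ℕ.∸ toℕ g)) n)))

        H-x−g : H x−g ≡ ind x * f (toℕ x ℕ.+ (n ℕ.∸ toℕ g))
        H-x−g = trans (cong (λ b → ι (⌊ x ∈? D ⌋ ∧ ⌊ toFin x−g ∈? D ⌋ ∧ b))
                            (Equivalence.to T-≡ (ℕP.≡⇒≡ᵇ _ _ x−[x−g]≡g)))
                      (trans (ι-∧-true ⌊ x ∈? D ⌋ ⌊ toFin x−g ∈? D ⌋) (cong (λ y → ind x * ind y) (toFin-mod (toℕ x ℕ.+ (n ℕ.∸ toℕ g)))))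

      partners : + length (filterᵇ (test g x) (allFin n)) ≡ ind x * f (toℕ x ℕ.+ (n ℕ.∸ toℕ g))
      partners = begin
          + length (filterᵇ (test g x) (allFin n))
        ≡⟨ count-filter (test g x) (allFin n) ⟩
          listSum (map (λ y → ι (test g x y)) (allFin n))
        ≡⟨ cong listSum (LP.map-cong (λ y → cong (λ z → ι (test g x z)) (sym (toFin-toℕ y))) (allFin n)) ⟩
          listSum (map (λ y → H (toℕ y)) (allFin n))
        ≡⟨ listSum-allFin n H ⟩
          sumℤ n H
        ≡⟨ sumℤ-single n H x−g (m%n<n (toℕ x ℕ.+ (n ℕ.∸ toℕ g)) n) H-zero ⟩
          H x−g
        ≡⟨ H-x−g ⟩
          ind x * f (toℕ x ℕ.+ (n ℕ.∸ toℕ g)) ∎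
        where open ≡-Reasoning

    reps≡autocorr : ∀ g → + reps D g ≡ autocorr n f (n ℕ.∸ toℕ g)
    reps≡autocorr g = begin
        + reps D g
      ≡⟨ count-filter P pairs ⟩
        listSum (map (λ xy → ι (P xy)) pairs)
      ≡⟨ listSum-concatMap (λ xy → ι (P xy)) (λ x → map (x ,_) (allFin n)) (allFin n) ⟩
        listSum (map (λ x → listSum (map (λ xy → ι (P xy)) (map (x ,_) (allFin n)))) (allFin n))
      ≡⟨ cong listSum (LP.map-cong per-x (allFin n)) ⟩
        listSum (map (λ x → f (toℕ x) * f (toℕ x ℕ.+ (n ℕ.∸ toℕ g))) (allFin n))
      ≡⟨ listSum-allFin n (λ i → f i * f (i ℕ.+ (n ℕ.∸ toℕ g))) ⟩
        autocorr n f (n ℕ.∸ toℕ g) ∎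
      where
      open ≡-Reasoning
      P : Fin n × Fin n → Bool
      P xy = test g (proj₁ xy) (proj₂ xy)
      pairs : List (Fin n × Fin n)
      pairs = concatMap (λ x → map (x ,_) (allFin n)) (allFin n)
      per-x : ∀ x → listSum (map (λ xy → ι (P xy)) (map (x ,_) (allFin n))) ≡ f (toℕ x) * f (toℕ x ℕ.+ (n ℕ.∸ toℕ g))
      per-x x = begin
          listSum (map (λ xy → ι (P xy)) (map (x ,_) (allFin n)))
        ≡⟨ cong listSum (sym (LP.map-∘ {g = λ xy → ι (P xy)} {f = x ,_} (allFin n))) ⟩
          listSum (map (λ y → ι (test g x y)) (allFin n))
        ≡⟨ sym (count-filter (test g x) (allFin n)) ⟩
          + length (filterᵇ (test g x) (allFin n))
        ≡⟨ partners g x ⟩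
          ind x * f (toℕ x ℕ.+ (n ℕ.∸ toℕ g))
        ≡⟨ cong (λ y → ind y * f (toℕ x ℕ.+ (n ℕ.∸ toℕ g))) (sym (toFin-toℕ x)) ⟩
          f (toℕ x) * f (toℕ x ℕ.+ (n ℕ.∸ toℕ g)) ∎

    size≡autocorr : + ∣ D ∣ ≡ autocorr n f 0
    size≡autocorr = begin
        + ∣ D ∣
      ≡⟨ size-as-sum D ⟩
        listSum (tabulate (λ x → ind x))
      ≡⟨ cong listSum (trans (LP.tabulate-cong (λ x → cong ind (sym (toFin-toℕ x)))) (sym (LP.map-tabulate {n = n} (λ x → x) (λ x → f (toℕ x))))) ⟩
        listSum (map (λ x → f (toℕ x)) (allFin n))
      ≡⟨ listSum-allFin n f ⟩
        sumℤ n f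
      ≡⟨ sumℤ-cong n (λ i _ → sym (trans (cong (λ j → f i * f j) (ℕP.+-identityʳ i)) (idempotent (f i) ⌊ toFin i ∈? D ⌋ refl))) ⟩
        autocorr n f 0 ∎
      where
      open ≡-Reasoning
      idempotent : ∀ z b → z ≡ ι b → z * z ≡ z
      idempotent _ true refl = refl
      idempotent _ false refl = refl

module Obstructions where

  open import Data.Nat as ℕ using (ℕ; suc)
  import Data.Nat.Properties as ℕP
  open import Data.Nat.Primality using (Prime)
  open import Data.Integer using (+_; -[1+_]; _+_; _*_; _-_; ∣_∣)
  import Data.Integer.Properties as ℤP
  open import Data.Integer.Tactic.RingSolver using (solve-∀)
  open import Data.Fin using (Fin; toℕ; fromℕ<)
  import Data.Fin.Properties as FinP
  open import Data.Fin.Subset using (Subset)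
  open NumberTheory using (normForm; normForm-scale; normForm-valuation-even)
  open Autocorrelation using (module OffPeak; sumℤ-cong; sumℤ-const)
  open DifferenceSets using (module Indicator)

  -- If a cyclic (n, k, λ) difference set exists and 3 ∣ n, then k − λ = u² − uv + v² for some integers u, v:
  -- its indicator sequence has autocorrelation k at 0 and λ at every other shift.
  difference-set⇒norm : ∀ N k l (D : Subset (suc N ℕ.* 3)) → IsCyclicDifferenceSet (suc N ℕ.* 3) k l D →
    ∃[ u ] ∃[ v ] normForm u v ≡ + k - + l
  difference-set⇒norm N k l D (size≡k , reps≡l) =
    s 0 - s 2 , s 1 - s 2 , trans off-peak-identity (cong (_- + l) (trans (sym size≡autocorr) (cong +_ size≡k)))
    where
    open Indicator (suc (suc (N ℕ.* 3))) D
    constant : ∀ t → 1 ℕ.≤ t → t ℕ.< n → autocorr n f t ≡ + l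
    constant t 1≤t t<n = trans (cong (autocorr n f) (sym n−g≡t)) (trans (sym (reps≡autocorr g)) (cong +_ (reps≡l g g≢0)))
      where
      n−t<n : n ℕ.∸ t ℕ.< n
      n−t<n = ℕP.∸-monoʳ-< {n} {t} {0} 1≤t (ℕP.<⇒≤ t<n)
      g : Fin n
      g = fromℕ< n−t<n
      n−g≡t : n ℕ.∸ toℕ g ≡ t
      n−g≡t = trans (cong (n ℕ.∸_) (FinP.toℕ-fromℕ< n−t<n)) (ℕP.m∸[m∸n]≡n (ℕP.<⇒≤ t<n))
      g≢0 : toℕ g ≢ 0
      g≢0 g≡0 = ℕP.<-irrefl (sym (trans (sym (FinP.toℕ-fromℕ< n−t<n)) g≡0)) (ℕP.m<n⇒0<n∸m t<n)
    open OffPeak N f periodic (+ l) constant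

  binary-sequence⇒norm : ∀ N a c → IsBinarySequence (suc N ℕ.* 3) a →
    (∀ t → 1 ℕ.≤ t → t ℕ.< suc N ℕ.* 3 → autocorr (suc N ℕ.* 3) a t ≡ c) →
    ∃[ u ] ∃[ v ] normForm u v ≡ + (suc N ℕ.* 3) - c
  binary-sequence⇒norm N a c (±1 , periodic) constant =
    s 0 - s 2 , s 1 - s 2 , trans off-peak-identity (cong (_- c) peak)
    where
    open OffPeak N a periodic c constant
    square-one : ∀ x → x ≡ + 1 ⊎ x ≡ -[1+ 0 ] → x * x ≡ + 1
    square-one _ (inj₁ refl) = refl
    square-one _ (inj₂ refl) = refl
    peak : autocorr n a 0 ≡ + n
    peak = trans (sumℤ-cong n (λ i _ → trans (cong (λ j → a i * a j) (ℕP.+-identityʳ i)) (square-one (a i) (±1 i))))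
                 (trans (sumℤ-const n (+ 1)) (ℤP.*-identityʳ (+ n)))

  norm-multiple-valuation-even : ∀ {p} → Prime p → p ℕ.% 3 ≡ 2 → ∀ c M u v → normForm u v ≡ + M →
    ¬ OddValuation p (c ℕ.* c ℕ.* M)
  norm-multiple-valuation-even {p} pr p%3≡2 c M u v N≡M =
    subst (λ m → ¬ OddValuation p m) scaled (normForm-valuation-even pr p%3≡2 (+ c * u) (+ c * v))
    where
    scaled : ∣ normForm (+ c * u) (+ c * v) ∣ ≡ c ℕ.* c ℕ.* M
    scaled = cong ∣_∣ (trans (normForm-scale (+ c) u v) (trans (cong (+ c * + c *_) N≡M) (sym positive)))
      where
      positive : + (c ℕ.* c ℕ.* M) ≡ + c * + c * + M
      positive = trans (ℤP.pos-* (c ℕ.* c) M) (cong (_* + M) (ℤP.pos-* c c))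

  +-minus : ∀ m n → + (m ℕ.+ n) - + m ≡ + n
  +-minus m n = trans (cong (_- + m) (ℤP.pos-+ m n)) (cancel (+ m) (+ n))
    where
    cancel : ∀ a b → a + b - a ≡ b
    cancel = solve-∀

  no-difference-set : ∀ {p n k l} → Prime p → p ℕ.% 3 ≡ 2 → ∀ N M → OddValuation p (16 ℕ.* M) →
    n ≡ suc N ℕ.* 3 → k ≡ l ℕ.+ M → ¬ (∃[ D ] IsCyclicDifferenceSet n k l D)
  no-difference-set {l = l} pr p%3≡2 N M odd refl refl (D , cds) = impossible (difference-set⇒norm N (l ℕ.+ M) l D cds)
    where
    impossible : ∃[ u ] ∃[ v ] normForm u v ≡ + (l ℕ.+ M) - + l → ⊥
    impossible (u , v , N≡k−l) = norm-multiple-valuation-even pr p%3≡2 4 M u v (trans N≡k−l (+-minus l M)) odd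

  no-perfect-sequence : ∀ {p n} → Prime p → p ℕ.% 3 ≡ 2 → ∀ N M → OddValuation p (16 ℕ.* M) →
    n ≡ suc N ℕ.* 3 → suc N ℕ.* 3 ≡ 3 ℕ.+ 4 ℕ.* M →
    ¬ (∃[ a ] (IsBinarySequence n a × (∀ t → 1 ℕ.≤ t → t ℕ.< n → autocorr n a t ≡ + 3)))
  no-perfect-sequence {p} pr p%3≡2 N M odd refl n≡3+4M (a , binary , constant) =
    impossible (binary-sequence⇒norm N a (+ 3) binary constant)
    where
    n−3≡4M : + (suc N ℕ.* 3) - + 3 ≡ + (4 ℕ.* M)
    n−3≡4M = trans (cong (λ n → + n - + 3) n≡3+4M) (+-minus 3 (4 ℕ.* M))
    impossible : ∃[ u ] ∃[ v ] normForm u v ≡ + (suc N ℕ.* 3) - + 3 → ⊥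
    impossible (u , v , N≡n−3) = norm-multiple-valuation-even pr p%3≡2 2 (4 ℕ.* M) u v (trans N≡n−3 n−3≡4M)
                                   (subst (OddValuation p) (ℕP.*-assoc 4 4 M) odd)

open import Data.Nat using (ℕ; zero; suc; NonZero; _+_; _*_; _∸_; _≤_; _<_)
open import Data.Nat.Properties using (m+n∸m≡n)
open import Data.Nat.DivMod using (_%_; _/_; m*n/n≡m; m≡m%n+[m/n]*n)
open import Data.Nat.Primality using (Prime)
open import Data.Nat.Tactic.RingSolver using (solve-∀)
open import Data.Integer using (+_)
open Obstructions using (no-difference-set; no-perfect-sequence)

record Parameters (A : ℕ) : Set where
  field
    N L M : ℕ
    n≡ : (A * A + 3) / 4 ≡ suc N * 3
    k≡ : ((A ∸ 1) * (A ∸ 3)) / 8 ≡ L + M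
    λ≡ : ((A ∸ 3) * (A ∸ 5)) / 16 ≡ L
    n≡3+4M : suc N * 3 ≡ 3 + 4 * M
    A²−9≡ : A * A ∸ 9 ≡ 16 * M

parameters-from : ∀ A N L M → A * A + 3 ≡ suc N * 3 * 4 → (A ∸ 1) * (A ∸ 3) ≡ (L + M) * 8 →
  (A ∸ 3) * (A ∸ 5) ≡ L * 16 → suc N * 3 ≡ 3 + 4 * M → A * A ≡ 9 + 16 * M → Parameters A
parameters-from A N L M n·4 k·8 λ·16 n≡3+4M A² = record
  { N = N ; L = L ; M = M
  ; n≡ = exact n·4 ; k≡ = exact k·8 ; λ≡ = exact λ·16
  ; n≡3+4M = n≡3+4M
  ; A²−9≡ = trans (cong (_∸ 9) A²) (m+n∸m≡n 9 (16 * M)) }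
  where
  exact : ∀ {x q d} .{{_ : NonZero d}} → x ≡ q * d → x / d ≡ q
  exact {q = q} {d} x≡qd = trans (cong (_/ d) x≡qd) (m*n/n≡m q d)

-- A ≡ ±3 (mod 24) means A = 3, A = 27 + 24m or A = 21 + 24m; in each case the parameters are polynomials in m.
parameters : ∀ A → A % 24 ≡ 3 ⊎ A % 24 ≡ 21 → Parameters A
parameters A (inj₁ A%24≡3) = from-quotient (A / 24) (trans (m≡m%n+[m/n]*n A 24) (cong (_+ (A / 24) * 24) A%24≡3))
  where
  from-quotient : ∀ q → A ≡ 3 + q * 24 → Parameters A
  from-quotient zero refl = parameters-from 3 0 0 0 refl refl refl refl refl
  from-quotient (suc m) refl = parameters-from (27 + m * 24) (60 + 108 * m + 48 * (m * m))
    (33 + 69 * m + 36 * (m * m)) (45 + 81 * m + 36 * (m * m)) (n·4 m) (k·8 m) (λ·16 m) (n≡3+4M m) (A² m)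
    where
    n·4 : ∀ m → (27 + m * 24) * (27 + m * 24) + 3 ≡ suc (60 + 108 * m + 48 * (m * m)) * 3 * 4
    n·4 = solve-∀
    k·8 : ∀ m → (26 + m * 24) * (24 + m * 24) ≡ (33 + 69 * m + 36 * (m * m) + (45 + 81 * m + 36 * (m * m))) * 8
    k·8 = solve-∀
    λ·16 : ∀ m → (24 + m * 24) * (22 + m * 24) ≡ (33 + 69 * m + 36 * (m * m)) * 16
    λ·16 = solve-∀
    n≡3+4M : ∀ m → suc (60 + 108 * m + 48 * (m * m)) * 3 ≡ 3 + 4 * (45 + 81 * m + 36 * (m * m))
    n≡3+4M = solve-∀
    A² : ∀ m → (27 + m * 24) * (27 + m * 24) ≡ 9 + 16 * (45 + 81 * m + 36 * (m * m))
    A² = solve-∀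
parameters A (inj₂ A%24≡21) = from-quotient (A / 24) (trans (m≡m%n+[m/n]*n A 24) (cong (_+ (A / 24) * 24) A%24≡21))
  where
  from-quotient : ∀ m → A ≡ 21 + m * 24 → Parameters A
  from-quotient m refl = parameters-from (21 + m * 24) (36 + 84 * m + 48 * (m * m))
    (18 + 51 * m + 36 * (m * m)) (27 + 63 * m + 36 * (m * m)) (n·4 m) (k·8 m) (λ·16 m) (n≡3+4M m) (A² m)
    where
    n·4 : ∀ m → (21 + m * 24) * (21 + m * 24) + 3 ≡ suc (36 + 84 * m + 48 * (m * m)) * 3 * 4
    n·4 = solve-∀
    k·8 : ∀ m → (20 + m * 24) * (18 + m * 24) ≡ (18 + 51 * m + 36 * (m * m) + (27 + 63 * m + 36 * (m * m))) * 8
    k·8 = solve-∀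
    λ·16 : ∀ m → (18 + m * 24) * (16 + m * 24) ≡ (18 + 51 * m + 36 * (m * m)) * 16
    λ·16 = solve-∀
    n≡3+4M : ∀ m → suc (36 + 84 * m + 48 * (m * m)) * 3 ≡ 3 + 4 * (27 + 63 * m + 36 * (m * m))
    n≡3+4M = solve-∀
    A² : ∀ m → (21 + m * 24) * (21 + m * 24) ≡ 9 + 16 * (27 + 63 * m + 36 * (m * m))
    A² = solve-∀

theorem4p1 : (A : ℕ) → 0 < A → (A % 24 ≡ 3 ⊎ A % 24 ≡ 21) →
  (∃[ p ] (Prime p × p % 3 ≡ 2 × OddValuation p (A * A ∸ 9))) →
  (¬ (∃[ D ] IsCyclicDifferenceSet ((A * A + 3) / 4) (((A ∸ 1) * (A ∸ 3)) / 8) (((A ∸ 3) * (A ∸ 5)) / 16) D))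
  × (¬ (∃[ a ] (IsBinarySequence ((A * A + 3) / 4) a
      × (∀ t → 1 ≤ t → t < (A * A + 3) / 4 → autocorr ((A * A + 3) / 4) a t ≡ + 3))))
theorem4p1 A _ residue (p , p-prime , p%3≡2 , odd) =
  no-difference-set p-prime p%3≡2 N M odd′ n≡ (trans k≡ (cong (_+ M) (sym λ≡))) ,
  no-perfect-sequence p-prime p%3≡2 N M odd′ n≡ n≡3+4M
  where
  open Parameters (parameters A residue)
  odd′ : OddValuation p (16 * M)
  odd′ = subst (OddValuation p) A²−9≡ odd
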